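{- Let $G=(V,E)$ be an undirected simple graph, $k$ a positive integer and $\mathit{In}\subseteq E$ with $G[\mathit{In}]$ connected. Then $\mathcal S_{\mathrm{near}}(G,\mathit{In},k)=\mathcal S(G-E_{\mathrm{far}},\mathit{In},k)$.
   Context: $G[F]$ is the subgraph with edge set $F$ and vertex set the endpoints of $F$; $V_{\mathit{In}}$ is the vertex set of $G[\mathit{In}]$. An edge $k$-graphlet is a connected $G[F]$ with $|F|=k$. $\mathcal S(G,\mathit{In},k)$ is the set of edge $k$-graphlets of $G$ whose edge set contains $\mathit{In}$. For a vertex set $X$ and edge $e=\{u,v\}$, $\mathrm{dist}(X,e)$ is the minimum over $w\in\{u,v\}$ of the distance in $G$ from $w$ to the nearest vertex of $X$. $E_{\mathrm{far}}=\{e\in E:\mathrm{dist}(V_{\mathit{In}},e)=k-|\mathit{In}|-1\}$ (far edges). $\mathcal S_{\mathrm{far}}(G,\mathit{In},k)$ is the set of members of $\mathcal S(G,\mathit{In},k)$ containing at least one far edge, and $\mathcal S_{\mathrm{near}}(G,\mathit{In},k)=\mathcal S(G,\mathit{In},k)\setminus\mathcal S_{\mathrm{far}}(G,\mathit{In},k)$. -}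

module Defs where

open import Data.Nat using (ℕ; zero; suc; _+_) renaming (_<_ to _<ℕ_)
open import Data.Fin using (Fin; _<_)
open import Data.Product using (Σ; ∃; _×_; _,_; proj₁; proj₂)
open import Data.Sum using (_⊎_)
open import Data.List using (List; length)
open import Data.List.Membership.Propositional using (_∈_)
open import Data.List.Relation.Unary.All using (All)
open import Data.List.Relation.Unary.Any using (Any)
open import Data.List.Relation.Unary.Unique.Propositional using (Unique)
open import Relation.Nullary using (¬_)
open import Relation.Binary.PropositionalEquality using (_≡_)

-- Vertices are Fin n.  An undirected edge {u,v} (u ≠ v) is represented
-- canonically by the ordered pair (u , v) with u < v.
Edge : ℕ → Set
Edge n = Fin n × Fin n

record Graph (n : ℕ) : Set₁ where
  field
    E       : Edge n → Set
    ordered : ∀ {u v} → E (u , v) → u < v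
open Graph public

_-ᴱ_ : ∀ {n} → Graph n → (Edge n → Set) → Graph n
G -ᴱ D = record { E = λ e → E G e × ¬ D e ; ordered = λ p → ordered G (proj₁ p) }

Adj : ∀ {n} → (Edge n → Set) → Fin n → Fin n → Set
Adj P u v = P (u , v) ⊎ P (v , u)

data Walk {n} (P : Edge n → Set) : Fin n → Fin n → ℕ → Set where
  here : ∀ {u} → Walk P u u zero
  step : ∀ {u v w d} → Adj P u v → Walk P v w d → Walk P u w (suc d)

Endpoint : ∀ {n} → Fin n → Edge n → Set
Endpoint x e = proj₁ e ≡ x ⊎ proj₂ e ≡ x

VSet : ∀ {n} → List (Edge n) → Fin n → Set
VSet F x = Any (Endpoint x) F

Connected : ∀ {n} → List (Edge n) → Set
Connected F = ∀ x y → VSet F x → VSet F y → ∃ λ d → Walk (_∈ F) x y d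

Reach : ∀ {n} → Graph n → (Fin n → Set) → Fin n → ℕ → Set
Reach G X w d = ∃ λ x → X x × Walk (E G) w x d

-- dist(X, e) = d, where dist(X,{u,v}) = min over w ∈ {u,v} of the
-- G-distance from w to the nearest vertex of X
DistE : ∀ {n} → Graph n → (Fin n → Set) → Edge n → ℕ → Set
DistE G X (u , v) d =
  (Reach G X u d ⊎ Reach G X v d) ×
  (∀ d′ → d′ <ℕ d → ¬ Reach G X u d′ × ¬ Reach G X v d′)

-- far edges: e ∈ E with dist(V_In, e) = k - |In| - 1
-- (written as dist + |In| + 1 = k to avoid truncated subtraction)
Far : ∀ {n} → Graph n → List (Edge n) → ℕ → Edge n → Set
Far G In k e = E G e × Σ ℕ λ d → DistE G (VSet In) e d × d + length In + 1 ≡ k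

-- F ∈ S(G, In, k): F ⊆ E, |F| = k, G[F] connected, In ⊆ F
-- (edge sets are duplicate-free lists)
InS : ∀ {n} → Graph n → List (Edge n) → ℕ → List (Edge n) → Set
InS G In k F = Unique F × All (E G) F × length F ≡ k × Connected F × All (_∈ F) In

InSfar : ∀ {n} → Graph n → List (Edge n) → ℕ → List (Edge n) → Set
InSfar G In k F = InS G In k F × Any (Far G In k) F

InSnear : ∀ {n} → Graph n → List (Edge n) → ℕ → List (Edge n) → Set
InSnear G In k F = InS G In k F × ¬ InSfar G In k F

module Submission where

open import Defs
open import Data.Nat using (ℕ; _<_)
open import Data.List using (List)
open import Data.List.Relation.Unary.All using (All; zip; unzip)
open import Data.List.Relation.Unary.All.Properties using (¬Any⇒All¬; All¬⇒¬Any)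
open import Data.List.Relation.Unary.Any using (Any)
open import Data.List.Relation.Unary.Unique.Propositional using (Unique)
open import Data.Product using (_×_; _,_)
open import Function.Bundles using (_⇔_; mk⇔; Equivalence)
import Function.Properties.Equivalence as ⇔
open import Relation.Nullary using (¬_)

-- The theorem is pure set algebra: deleting any edge set D from G keeps exactly
-- the graphlets of G that avoid D, and the near graphlets are by definition
-- those avoiding the far edges.  Neither the distance condition defining far
-- edges nor the hypotheses on k and In play a role.

module _ {n} (G : Graph n) (D : Edge n → Set) where

  All-E-delete⇔ : ∀ F → All (E (G -ᴱ D)) F ⇔ (All (E G) F × ¬ Any D F)
  All-E-delete⇔ F = mk⇔ to from
    where
    to : All (E (G -ᴱ D)) F → All (E G) F × ¬ Any D F
    to es with unzip es
    ... | inG , notD = inG , All¬⇒¬Any notD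

    from : All (E G) F × ¬ Any D F → All (E (G -ᴱ D)) F
    from (inG , avoidsD) = zip (inG , ¬Any⇒All¬ F avoidsD)

  InS-delete⇔ : ∀ In k F → InS (G -ᴱ D) In k F ⇔ (InS G In k F × ¬ Any D F)
  InS-delete⇔ In k F = mk⇔ to from
    where
    to : InS (G -ᴱ D) In k F → InS G In k F × ¬ Any D F
    to (u , es , l , c , i) with Equivalence.to (All-E-delete⇔ F) es
    ... | inG , avoidsD = (u , inG , l , c , i) , avoidsD

    from : InS G In k F × ¬ Any D F → InS (G -ᴱ D) In k F
    from ((u , inG , l , c , i) , avoidsD) =
      u , Equivalence.from (All-E-delete⇔ F) (inG , avoidsD) , l , c , i

InSnear⇔ : ∀ {n} (G : Graph n) In k F →
           InSnear G In k F ⇔ (InS G In k F × ¬ Any (Far G In k) F)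
InSnear⇔ G In k F =
  mk⇔ (λ (s , notFar) → s , λ far → notFar (s , far))
      (λ (s , avoidsFar) → s , λ (_ , far) → avoidsFar far)

lemma5 : ∀ {n} (G : Graph n) (k : ℕ) (In : List (Edge n)) →
         0 < k → Unique In → All (E G) In → Connected In →
         ∀ (F : List (Edge n)) →
         InSnear G In k F ⇔ InS (G -ᴱ Far G In k) In k F
lemma5 G k In _ _ _ _ F =
  ⇔.trans (InSnear⇔ G In k F) (⇔.sym (InS-delete⇔ G (Far G In k) In k F))
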